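{- AlgoFor-DDP-NS (described in the context) is a $\big(2+\frac{\epsilon_{max}-\epsilon_{min}}{1-\epsilon_{max}}\big)$-approximation algorithm for DDP-NS: on every instance it returns a feasible solution using at most $\big(2+\frac{\epsilon_{max}-\epsilon_{min}}{1-\epsilon_{max}}\big)OPT_{NS}$ drones.
   Context: Instance of DDP-NS: $n$ deliveries; delivery $j$ has a closed delivery time interval $I_j=[t_j^L,t_j^R]$ and cost $cost(I_j)\in(0,B]$, $B>0$ the common battery capacity of identical drones. Two intervals are compatible if disjoint, otherwise conflicting. A feasible assignment of a drone is a set of pairwise compatible delivery intervals with total cost at most $B$. $OPT_{NS}$ is the minimum number of drones such that every delivery is assigned to exactly one drone and each drone's assignment is feasible. $\omega$ is the maximum number of pairwise conflicting delivery intervals. $\epsilon_{min}=\frac1B\min_j cost(I_j)$, $\epsilon_{max}=\min\{\frac12,\frac1B\max_j cost(I_j)\}$. AlgoFor-DDP-NS: build the interval graph $G$ on the delivery intervals (adjacent iff conflicting); properly color $G$ with $\omega$ colors giving classes $\mathcal J_1,\dots,\mathcal J_\omega$; for each class separately, process its intervals one by one in arbitrary order, assigning $I_j$ to some already used drone of that class with remaining capacity at least $cost(I_j)$ if one exists (reducing its capacity by $cost(I_j)$), else to a new drone with remaining capacity $B-cost(I_j)$; output all drones used.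
   Formalization: The delivery times, the delivery costs and the battery capacity B are rational. -}

module Defs where

open import Data.Nat using (ℕ; zero; suc)
open import Data.Fin using (Fin)
open import Data.List using (List; []; _∷_; [_]; _++_; length; map; foldr; allFin; concat; concatMap; updateAt; lookup)
open import Data.List.Relation.Unary.All using (All)
open import Data.List.Relation.Unary.AllPairs using (AllPairs)
open import Data.List.Relation.Unary.Unique.Propositional using (Unique)
open import Data.List.Membership.Propositional using (_∈_)
open import Data.Rational using (ℚ; 0ℚ; 1ℚ; _+_; _-_; _*_; _÷_; _≤_; _<_; _⊓_; _⊔_; ½; ≢-nonZero)
open import Data.Rational.Properties using (_≟_)
open import Data.Product using (Σ; ∃; _×_; _,_)
open import Data.Sum using (_⊎_)
open import Function.Bundles using (_⇔_)
open import Relation.Nullary using (¬_; yes; no)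
open import Relation.Binary.PropositionalEquality using (_≡_; _≢_)

record Instance : Set where
  field
    n       : ℕ                -- number of deliveries
    B       : ℚ                -- battery capacity
    B-pos   : 0ℚ < B
    left    : Fin n → ℚ
    right   : Fin n → ℚ
    left≤right : ∀ j → left j ≤ right j
    cost    : Fin n → ℚ
    cost-pos : ∀ j → 0ℚ < cost j
    cost≤B  : ∀ j → cost j ≤ B

sumℚ : List ℚ → ℚ
sumℚ = foldr _+_ 0ℚ

-- total division (the fallback value is never used in the theorem, as 1 - ε_max ≥ 1/2)
_/?_ : ℚ → ℚ → ℚ
p /? q with q ≟ 0ℚ
... | yes _ = 0ℚ
... | no q≢0 = _÷_ p q {{≢-nonZero q≢0}}

module _ (I : Instance) where
  open Instance I

  -- closed intervals I_i, I_j are compatible iff disjoint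
  Compatible : Fin n → Fin n → Set
  Compatible i j = (right i < left j) ⊎ (right j < left i)

  Conflicting : Fin n → Fin n → Set
  Conflicting i j = ¬ Compatible i j

  IsClique : List (Fin n) → Set
  IsClique S = Unique S × AllPairs Conflicting S

  IsCliqueNumber : ℕ → Set
  IsCliqueNumber ω =
    (Σ (List (Fin n)) λ S → IsClique S × length S ≡ ω) ×
    (∀ S → IsClique S → length S Data.Nat.≤ ω)

  ProperColoring : (ω : ℕ) → (Fin n → Fin ω) → Set
  ProperColoring ω col = ∀ i j → i ≢ j → Conflicting i j → col i ≢ col j

  -- a drone is represented by the list of deliveries assigned to it
  load : List (Fin n) → ℚ
  load D = sumℚ (map cost D)

  FeasibleDrone : List (Fin n) → Set
  FeasibleDrone D = AllPairs Compatible D × load D ≤ B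

  FeasibleSolution : List (List (Fin n)) → Set
  FeasibleSolution ds =
    All FeasibleDrone ds × (∀ j → j ∈ concat ds) × Unique (concat ds)

  IsOPT : ℕ → Set
  IsOPT opt =
    (Σ (List (List (Fin n))) λ ds → FeasibleSolution ds × length ds ≡ opt) ×
    (∀ ds → FeasibleSolution ds → opt Data.Nat.≤ length ds)

  -- One run of the per-class greedy procedure:
  -- FFRun drones js out : starting with the used drones 'drones', processing the
  -- deliveries js in the listed order, the procedure may end with drones 'out'.
  data FFRun (drones : List (List (Fin n))) : List (Fin n) → List (List (Fin n)) → Set where
    done : FFRun drones [] drones
    old  : ∀ {j js out} (i : Fin (length drones)) →
           cost j ≤ B - load (lookup drones i) →
           FFRun (updateAt drones i (j ∷_)) js out →
           FFRun drones (j ∷ js) out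
    new  : ∀ {j js out} →
           (∀ (i : Fin (length drones)) → B - load (lookup drones i) < cost j) →
           FFRun (drones ++ [ [ j ] ]) js out →
           FFRun drones (j ∷ js) out

  -- ds is a possible output of AlgoFor-DDP-NS (over all choices of the proper
  -- ω-colouring, of the processing order inside each class, and of the drone
  -- chosen among those with enough remaining capacity)
  AlgoOutput : List (List (Fin n)) → Set
  AlgoOutput ds =
    Σ ℕ λ ω → IsCliqueNumber ω ×
    (Σ (Fin n → Fin ω) λ col → ProperColoring ω col ×
    (Σ (Fin ω → List (Fin n)) λ ord →
      (∀ k → Unique (ord k)) × (∀ k j → (j ∈ ord k) ⇔ (col j ≡ k)) ×
    (Σ (Fin ω → List (List (Fin n))) λ out →
      (∀ k → FFRun [] (ord k) (out k)) ×
      ds ≡ concatMap out (allFin ω))))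

  -- ε_min = min_j cost / B ; ε_max = min {1/2, max_j cost / B}
  -- (folding with B resp. 0 as neutral element is harmless since 0 < cost j ≤ B)
  minCost maxCost : ℚ
  minCost = foldr _⊓_ B (map cost (allFin n))
  maxCost = foldr _⊔_ 0ℚ (map cost (allFin n))

  εmin εmax : ℚ
  εmin = minCost /? B
  εmax = ½ ⊓ (maxCost /? B)

  ratio : ℚ
  ratio = (1ℚ + 1ℚ) + ((εmax - εmin) /? (1ℚ - εmax))

-- Each colour class consists of pairwise disjoint intervals, so First Fit inside a class only
-- has to respect the battery. A drone is opened for a delivery only when the delivery fits in no
-- open drone of its class; hence in every class at most one drone has load below
-- T = (1 - ε_max) B (a small delivery finds all open drones above T, a large one puts the new
-- drone above T), and every drone carries at least ε_min B. Summing over the ω classes, with A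
-- drones used and total cost L: A T ≤ L + ω (T - ε_min B) and A ε_min B ≤ L. Finally L ≤ OPT B,
-- and ω ≤ OPT because pairwise conflicting deliveries need pairwise different drones; the first
-- bound gives the ratio when ε_min B ≤ T, the second when T ≤ ε_min B.

module Submission where

open import Defs
open import Data.Nat using (ℕ)
open import Data.Fin using (Fin)
open import Data.List using (List; length)
open import Data.Rational using (ℚ; _/_; _*_; _≤_)
open import Data.Product using (_×_; _,_; proj₁; proj₂)
open import Data.Integer using (+_)

import Data.Fin.Properties as Fin
import Data.Integer as ℤ
import Data.Integer.Properties as ℤ
open import Data.List using ([]; _∷_; _++_; [_]; map; concat; concatMap; lookup; updateAt; allFin)
import Data.List.Properties as List
open import Data.List.Membership.Propositional using (_∈_)
open import Data.List.Membership.Propositional.Properties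
  using (∈-lookup; ∈-concat⁻; ∈-concat⁺′; ∈-map⁺; ∈-allFin)
open import Data.List.Membership.Propositional.Properties.WithK using (unique∧set⇒bag)
open import Data.List.Relation.Binary.BagAndSetEquality using (∼bag⇒↭)
open import Data.List.Relation.Binary.Disjoint.Propositional using (Disjoint)
open import Data.List.Relation.Binary.Permutation.Propositional
  using (_↭_; ↭-refl; ↭-sym; ↭-reflexive; ↭⇒↭ₛ; module PermutationReasoning)
open import Data.List.Relation.Binary.Permutation.Propositional.Properties
  using (++⁺ˡ; ++⁺; shift; ∈-resp-↭) renaming (map⁺ to ↭-map⁺; ++⁺ʳ to ↭-++⁺ʳ)
import Data.List.Relation.Binary.Permutation.Setoid.Properties as Permutationₛ
open import Data.List.Relation.Unary.All as All using (All; []; _∷_)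
import Data.List.Relation.Unary.All.Properties as All
open import Data.List.Relation.Unary.AllPairs as AllPairs using (AllPairs; []; _∷_)
import Data.List.Relation.Unary.AllPairs.Properties as AllPairs
open import Data.List.Relation.Unary.Any as Any using (here; there)
import Data.List.Relation.Unary.Any.Properties as Any
open import Data.List.Relation.Unary.Unique.Propositional using (Unique)
import Data.List.Relation.Unary.Unique.Propositional.Properties as Unique
open import Data.Nat as ℕ using (suc)
import Data.Nat.Properties as ℕ
open import Data.Rational
  using (0ℚ; 1ℚ; ½; toℚᵘ; 1/_; *<*; _+_; _-_; -_; _<_; _⊔_; _⊓_; ≢-nonZero; positive; nonNegative)
open import Data.Rational.Properties
open import Data.Rational.Solver using (module +-*-Solver)
open import Data.Rational.Unnormalised as ℚᵘ using (mkℚᵘ)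
import Data.Rational.Unnormalised.Properties as ℚᵘ
open import Data.Sum as Sum using (_⊎_; inj₁; inj₂; [_,_]′)
open import Function using (_∘_; id)
open import Function.Bundles using (_⇔_; mk⇔; module Equivalence)
open import Relation.Binary.Definitions using (Symmetric)
open import Relation.Binary.PropositionalEquality hiding ([_])
open import Relation.Nullary using (¬_; Dec; yes; no; contradiction; _⊎-dec_)
open import Relation.Nullary.Decidable using (decidable-stable)

open +-*-Solver using (solve; _:=_; con; _:+_; _:*_; _:-_)

fromℕ : ℕ → ℚ
fromℕ n = + n / 1

fromℕ-+ : ∀ m n → fromℕ (m ℕ.+ n) ≡ fromℕ m + fromℕ n
fromℕ-+ m n = toℚᵘ-injective (begin-equality
  toℚᵘ (fromℕ (m ℕ.+ n))                ≃⟨ toℚᵘ-fromℕ (m ℕ.+ n) ⟩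
  mkℚᵘ (+ (m ℕ.+ n)) 0                  ≃⟨ ℚᵘ.*≡* numerators ⟩
  mkℚᵘ (+ m) 0 ℚᵘ.+ mkℚᵘ (+ n) 0        ≃⟨ ℚᵘ.+-cong (toℚᵘ-fromℕ m) (toℚᵘ-fromℕ n) ⟨
  toℚᵘ (fromℕ m) ℚᵘ.+ toℚᵘ (fromℕ n)    ≃⟨ toℚᵘ-homo-+ (fromℕ m) (fromℕ n) ⟨
  toℚᵘ (fromℕ m + fromℕ n)              ∎)
  where
  open ℚᵘ.≤-Reasoning
  toℚᵘ-fromℕ : ∀ k → toℚᵘ (fromℕ k) ℚᵘ.≃ mkℚᵘ (+ k) 0
  toℚᵘ-fromℕ k = toℚᵘ-fromℚᵘ (mkℚᵘ (+ k) 0)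
  numerators : + (m ℕ.+ n) ℤ.* + 1 ≡ (+ m ℤ.* + 1 ℤ.+ + n ℤ.* + 1) ℤ.* + 1
  numerators = cong (ℤ._* + 1) (trans (ℤ.pos-+ m n)
    (sym (cong₂ ℤ._+_ (ℤ.*-identityʳ (+ m)) (ℤ.*-identityʳ (+ n)))))

fromℕ-nonNeg : ∀ n → 0ℚ ≤ fromℕ n
fromℕ-nonNeg n = nonNegative⁻¹ (fromℕ n) {{normalize-nonNeg n 1}}

fromℕ-mono-≤ : ∀ {m n} → m ℕ.≤ n → fromℕ m ≤ fromℕ n
fromℕ-mono-≤ {m} m≤n with o , refl ← ℕ.m≤n⇒∃[o]m+o≡n m≤n = begin
  fromℕ m              ≡⟨ +-identityʳ (fromℕ m) ⟨
  fromℕ m + 0ℚ         ≤⟨ +-monoʳ-≤ (fromℕ m) (fromℕ-nonNeg o) ⟩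
  fromℕ m + fromℕ o    ≡⟨ fromℕ-+ m o ⟨
  fromℕ (m ℕ.+ o)      ∎
  where open ≤-Reasoning

*-fromℕ-suc : ∀ p n → p * fromℕ (suc n) ≡ p + p * fromℕ n
*-fromℕ-suc p n = begin
  p * fromℕ (1 ℕ.+ n)       ≡⟨ cong (p *_) (fromℕ-+ 1 n) ⟩
  p * (1ℚ + fromℕ n)        ≡⟨ *-distribˡ-+ p 1ℚ (fromℕ n) ⟩
  p * 1ℚ + p * fromℕ n      ≡⟨ cong (_+ p * fromℕ n) (*-identityʳ p) ⟩
  p + p * fromℕ n           ∎
  where open ≡-Reasoning

p≤q⇒0≤q-p : ∀ {p q} → p ≤ q → 0ℚ ≤ q - p
p≤q⇒0≤q-p {p} {q} p≤q = subst (_≤ q - p) (+-inverseʳ p) (+-monoˡ-≤ (- p) p≤q)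

p<q⇒0<q-p : ∀ {p q} → p < q → 0ℚ < q - p
p<q⇒0<q-p {p} {q} p<q = subst (_< q - p) (+-inverseʳ p) (+-monoˡ-< (- p) p<q)

0≤* : ∀ {p q} → 0ℚ ≤ p → 0ℚ ≤ q → 0ℚ ≤ p * q
0≤* {p} {q} 0≤p 0≤q =
  nonNegative⁻¹ (p * q) {{nonNeg*nonNeg⇒nonNeg p {{nonNegative 0≤p}} q {{nonNegative 0≤q}}}}

0<* : ∀ {p q} → 0ℚ < p → 0ℚ < q → 0ℚ < p * q
0<* {p} {q} 0<p 0<q = positive⁻¹ (p * q) {{pos*pos⇒pos p {{positive 0<p}} q {{positive 0<q}}}}

/?-*-cancel : ∀ p {q} → q ≢ 0ℚ → (p /? q) * q ≡ p
/?-*-cancel p {q} q≢0 with q ≟ 0ℚ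
... | yes q≡0 = contradiction q≡0 q≢0
... | no _ = begin
  p * 1/ q * q      ≡⟨ *-assoc p (1/ q) q ⟩
  p * (1/ q * q)    ≡⟨ cong (p *_) (*-inverseˡ q) ⟩
  p * 1ℚ            ≡⟨ *-identityʳ p ⟩
  p                 ∎
  where
  instance _ = ≢-nonZero q≢0
  open ≡-Reasoning

module _ {e a : ℚ} (e<1 : e < 1ℚ) where

  private
    0<1-e : 0ℚ < 1ℚ - e
    0<1-e = p<q⇒0<q-p e<1

  ratio*[1-e] : ((1ℚ + 1ℚ) + (e - a) /? (1ℚ - e)) * (1ℚ - e) ≡ 1ℚ + (1ℚ - e) - a
  ratio*[1-e] = begin
    ((1ℚ + 1ℚ) + (e - a) /? (1ℚ - e)) * (1ℚ - e)
      ≡⟨ *-distribʳ-+ (1ℚ - e) (1ℚ + 1ℚ) ((e - a) /? (1ℚ - e)) ⟩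
    (1ℚ + 1ℚ) * (1ℚ - e) + (e - a) /? (1ℚ - e) * (1ℚ - e)
      ≡⟨ cong (_+_ ((1ℚ + 1ℚ) * (1ℚ - e))) e-a≡ ⟩
    (1ℚ + 1ℚ) * (1ℚ - e) + (e - a)                        ≡⟨ simplify e a ⟩
    1ℚ + (1ℚ - e) - a                                     ∎
    where
    open ≡-Reasoning
    e-a≡ : (e - a) /? (1ℚ - e) * (1ℚ - e) ≡ e - a
    e-a≡ = /?-*-cancel (e - a) (≢-sym (<⇒≢ 0<1-e))
    simplify : ∀ x y → (1ℚ + 1ℚ) * (1ℚ - x) + (x - y) ≡ 1ℚ + (1ℚ - x) - y
    simplify = solve 2 (λ x y → (con 1ℚ :+ con 1ℚ) :* (con 1ℚ :- x) :+ (x :- y)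
                             := con 1ℚ :+ (con 1ℚ :- x) :- y) refl

  -- a (1 + (1 - e) - a) exceeds 1 - e by (1 - a) (a - (1 - e)).
  1≤ratio*a : a ≤ 1ℚ → 1ℚ - e ≤ a → 1ℚ ≤ ((1ℚ + 1ℚ) + (e - a) /? (1ℚ - e)) * a
  1≤ratio*a a≤1 1-e≤a = *-cancelʳ-≤-pos (1ℚ - e) {{positive 0<1-e}} (begin
    1ℚ * (1ℚ - e)                             ≡⟨ *-identityˡ (1ℚ - e) ⟩
    1ℚ - e                                    ≡⟨ +-identityʳ (1ℚ - e) ⟨
    (1ℚ - e) + 0ℚ                             ≤⟨ +-monoʳ-≤ (1ℚ - e) (0≤* (p≤q⇒0≤q-p a≤1) (p≤q⇒0≤q-p 1-e≤a)) ⟩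
    (1ℚ - e) + (1ℚ - a) * (a - (1ℚ - e))      ≡⟨ complete e a ⟩
    a * (1ℚ + (1ℚ - e) - a)                   ≡⟨ cong (a *_) ratio*[1-e] ⟨
    a * (R * (1ℚ - e))                        ≡⟨ *-assoc a R (1ℚ - e) ⟨
    a * R * (1ℚ - e)                          ≡⟨ cong (_* (1ℚ - e)) (*-comm a R) ⟩
    R * a * (1ℚ - e)                          ∎)
    where
    open ≤-Reasoning
    R = (1ℚ + 1ℚ) + (e - a) /? (1ℚ - e)
    complete : ∀ x y → (1ℚ - x) + (1ℚ - y) * (y - (1ℚ - x)) ≡ y * (1ℚ + (1ℚ - x) - y)
    complete = solve 2 (λ x y → (con 1ℚ :- x) :+ (con 1ℚ :- y) :* (y :- (con 1ℚ :- x))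
                             := y :* (con 1ℚ :+ (con 1ℚ :- x) :- y)) refl

  -- A, O, W, L play the number of drones used, OPT, ω and the total cost; T = (1 - e) B, c = a B.
  ratio-bound : ∀ {B A O W L} → 0ℚ < B → a ≤ 1ℚ →
    (1ℚ - e) * B * A ≤ L + W * (0ℚ ⊔ ((1ℚ - e) * B - a * B)) →
    a * B * A ≤ L → L ≤ B * O → W ≤ O → 0ℚ ≤ O →
    A ≤ ((1ℚ + 1ℚ) + (e - a) /? (1ℚ - e)) * O
  ratio-bound {B} {A} {O} {W} {L} 0<B a≤1 count lower total W≤O 0≤O =
    [ via-count , via-lower ]′ (≤-total (a * B) ((1ℚ - e) * B))
    where
    open ≤-Reasoning
    R = (1ℚ + 1ℚ) + (e - a) /? (1ℚ - e)

    via-count : a * B ≤ (1ℚ - e) * B → A ≤ R * O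
    via-count c≤T = *-cancelʳ-≤-pos ((1ℚ - e) * B) {{positive (0<* 0<1-e 0<B)}} (begin
      A * ((1ℚ - e) * B)                         ≡⟨ *-comm A _ ⟩
      (1ℚ - e) * B * A                           ≤⟨ count ⟩
      L + W * (0ℚ ⊔ ((1ℚ - e) * B - a * B))      ≡⟨ cong (λ g → L + W * g) (p≤q⇒p⊔q≡q 0≤T-c) ⟩
      L + W * ((1ℚ - e) * B - a * B)             ≤⟨ +-mono-≤ total (*-monoʳ-≤-nonNeg _ {{nonNegative 0≤T-c}} W≤O) ⟩
      B * O + O * ((1ℚ - e) * B - a * B)         ≡⟨ factor B e a O ⟩
      O * B * (1ℚ + (1ℚ - e) - a)                ≡⟨ cong (O * B *_) ratio*[1-e] ⟨
      O * B * (R * (1ℚ - e))                     ≡⟨ regroup O B R (1ℚ - e) ⟩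
      R * O * ((1ℚ - e) * B)                     ∎)
      where
      0≤T-c : 0ℚ ≤ (1ℚ - e) * B - a * B
      0≤T-c = p≤q⇒0≤q-p c≤T
      factor : ∀ b x y o → b * o + o * ((1ℚ - x) * b - y * b) ≡ o * b * (1ℚ + (1ℚ - x) - y)
      factor = solve 4 (λ b x y o → b :* o :+ o :* ((con 1ℚ :- x) :* b :- y :* b)
                                 := o :* b :* (con 1ℚ :+ (con 1ℚ :- x) :- y)) refl
      regroup : ∀ x y z w → x * y * (z * w) ≡ z * x * (w * y)
      regroup = solve 4 (λ x y z w → x :* y :* (z :* w) := z :* x :* (w :* y)) refl

    via-lower : (1ℚ - e) * B ≤ a * B → A ≤ R * O
    via-lower T≤c = *-cancelʳ-≤-pos (a * B) {{positive (0<* 0<a 0<B)}} (begin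
      A * (a * B)          ≡⟨ *-comm A _ ⟩
      a * B * A            ≤⟨ lower ⟩
      L                    ≤⟨ total ⟩
      B * O                ≡⟨ *-identityˡ (B * O) ⟨
      1ℚ * (B * O)         ≤⟨ *-monoʳ-≤-nonNeg (B * O) {{nonNegative 0≤BO}} (1≤ratio*a a≤1 1-e≤a) ⟩
      R * a * (B * O)      ≡⟨ regroup R a B O ⟩
      R * O * (a * B)      ∎)
      where
      1-e≤a : 1ℚ - e ≤ a
      1-e≤a = *-cancelʳ-≤-pos B {{positive 0<B}} T≤c
      0<a : 0ℚ < a
      0<a = <-≤-trans 0<1-e 1-e≤a
      0≤BO : 0ℚ ≤ B * O
      0≤BO = 0≤* (<⇒≤ 0<B) 0≤O
      regroup : ∀ x y z w → x * y * (z * w) ≡ x * w * (y * z)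
      regroup = solve 4 (λ x y z w → x :* y :* (z :* w) := x :* w :* (y :* z)) refl

sumℚ-++ : ∀ xs ys → sumℚ (xs ++ ys) ≡ sumℚ xs + sumℚ ys
sumℚ-++ []       ys = sym (+-identityˡ (sumℚ ys))
sumℚ-++ (x ∷ xs) ys = trans (cong (_+_ x) (sumℚ-++ xs ys)) (sym (+-assoc x (sumℚ xs) (sumℚ ys)))

sumℚ-map-++ : ∀ {A : Set} (w : A → ℚ) xs ys →
              sumℚ (map w (xs ++ ys)) ≡ sumℚ (map w xs) + sumℚ (map w ys)
sumℚ-map-++ w xs ys = trans (cong sumℚ (List.map-++ w xs ys)) (sumℚ-++ (map w xs) (map w ys))

Unique-resp-↭ : ∀ {A : Set} {xs ys : List A} → xs ↭ ys → Unique xs → Unique ys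
Unique-resp-↭ {A} xs↭ys = Permutationₛ.Unique-resp-↭ (setoid A) (↭⇒↭ₛ xs↭ys)

sumℚ-↭ : ∀ {xs ys} → xs ↭ ys → sumℚ xs ≡ sumℚ ys
sumℚ-↭ xs↭ys = Permutationₛ.foldr-commMonoid (setoid ℚ) +-0-isCommutativeMonoid (↭⇒↭ₛ xs↭ys)

*-length≤sumℚ : ∀ {A : Set} (w : A → ℚ) {c} xs → All (λ x → c ≤ w x) xs →
                c * fromℕ (length xs) ≤ sumℚ (map w xs)
*-length≤sumℚ w {c} []       []           = ≤-reflexive (*-zeroʳ c)
*-length≤sumℚ w {c} (x ∷ xs) (c≤x ∷ c≤xs) = begin
  c * fromℕ (suc (length xs))   ≡⟨ *-fromℕ-suc c (length xs) ⟩
  c + c * fromℕ (length xs)     ≤⟨ +-mono-≤ c≤x (*-length≤sumℚ w xs c≤xs) ⟩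
  w x + sumℚ (map w xs)         ∎
  where open ≤-Reasoning

sumℚ≤*-length : ∀ {A : Set} (w : A → ℚ) {b} xs → All (λ x → w x ≤ b) xs →
                sumℚ (map w xs) ≤ b * fromℕ (length xs)
sumℚ≤*-length w {b} []       []           = ≤-reflexive (sym (*-zeroʳ b))
sumℚ≤*-length w {b} (x ∷ xs) (x≤b ∷ xs≤b) = begin
  w x + sumℚ (map w xs)         ≤⟨ +-mono-≤ x≤b (sumℚ≤*-length w xs xs≤b) ⟩
  b + b * fromℕ (length xs)     ≡⟨ *-fromℕ-suc b (length xs) ⟨
  b * fromℕ (suc (length xs))   ∎
  where open ≤-Reasoning

-- At most one weight lies below T, and it is at least c: it falls short of T by at most T - c.
*-length≤sumℚ+gap : ∀ {A : Set} (w : A → ℚ) {c T} xs → All (λ x → c ≤ w x) xs →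
                    AllPairs (λ x y → T ≤ w x ⊎ T ≤ w y) xs →
                    T * fromℕ (length xs) ≤ sumℚ (map w xs) + (0ℚ ⊔ (T - c))
*-length≤sumℚ+gap w {c} {T} [] [] [] = begin
  T * 0ℚ              ≡⟨ *-zeroʳ T ⟩
  0ℚ                  ≤⟨ p≤p⊔q 0ℚ (T - c) ⟩
  0ℚ ⊔ (T - c)        ≡⟨ +-identityˡ (0ℚ ⊔ (T - c)) ⟨
  0ℚ + (0ℚ ⊔ (T - c)) ∎
  where open ≤-Reasoning
*-length≤sumℚ+gap w {c} {T} (x ∷ xs) (c≤x ∷ c≤xs) (T≤x∨T≤ ∷ T≤∨T≤) with T ≤? w x
... | yes T≤x = begin
  T * fromℕ (suc (length xs))                ≡⟨ *-fromℕ-suc T (length xs) ⟩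
  T + T * fromℕ (length xs)                  ≤⟨ +-mono-≤ T≤x (*-length≤sumℚ+gap w xs c≤xs T≤∨T≤) ⟩
  w x + (sumℚ (map w xs) + (0ℚ ⊔ (T - c)))   ≡⟨ +-assoc (w x) (sumℚ (map w xs)) _ ⟨
  w x + sumℚ (map w xs) + (0ℚ ⊔ (T - c))     ∎
  where open ≤-Reasoning
... | no T≰x = begin
  T * fromℕ (suc (length xs))                ≡⟨ *-fromℕ-suc T (length xs) ⟩
  T + T * fromℕ (length xs)                  ≤⟨ +-mono-≤ T≤x+gap (*-length≤sumℚ w xs T≤xs) ⟩
  w x + (0ℚ ⊔ (T - c)) + sumℚ (map w xs)     ≡⟨ swap-last (w x) (0ℚ ⊔ (T - c)) (sumℚ (map w xs)) ⟩
  w x + sumℚ (map w xs) + (0ℚ ⊔ (T - c))     ∎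
  where
  open ≤-Reasoning
  T≤xs : All (λ y → T ≤ w y) xs
  T≤xs = All.map (λ { (inj₁ T≤x) → contradiction T≤x T≰x ; (inj₂ T≤y) → T≤y }) T≤x∨T≤
  split : ∀ t u → t ≡ u + (t - u)
  split = solve 2 (λ t u → t := u :+ (t :- u)) refl
  T≤x+gap : T ≤ w x + (0ℚ ⊔ (T - c))
  T≤x+gap = begin
    T                       ≡⟨ split T c ⟩
    c + (T - c)             ≤⟨ +-mono-≤ c≤x (p≤q⊔p 0ℚ (T - c)) ⟩
    w x + (0ℚ ⊔ (T - c))    ∎
  swap-last : ∀ p q r → p + q + r ≡ p + r + q
  swap-last = solve 3 (λ p q r → p :+ q :+ r := p :+ r :+ q) refl

*-length-concat≤ : ∀ {A : Set} {T M} (w : A → ℚ) xss →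
  All (λ xs → T * fromℕ (length xs) ≤ sumℚ (map w xs) + M) xss →
  T * fromℕ (length (concat xss)) ≤ sumℚ (map w (concat xss)) + fromℕ (length xss) * M
*-length-concat≤ {T = T} {M} w [] [] = ≤-reflexive (begin
  T * 0ℚ         ≡⟨ *-zeroʳ T ⟩
  0ℚ             ≡⟨ *-zeroˡ M ⟨
  0ℚ * M         ≡⟨ +-identityˡ (0ℚ * M) ⟨
  0ℚ + 0ℚ * M    ∎)
  where open ≡-Reasoning
*-length-concat≤ {T = T} {M} w (xs ∷ xss) (bound ∷ bounds) = begin
  T * fromℕ (length (xs ++ concat xss))                  ≡⟨ cong (λ k → T * fromℕ k) (List.length-++ xs) ⟩
  T * fromℕ (length xs ℕ.+ length (concat xss))          ≡⟨ cong (T *_) (fromℕ-+ (length xs) _) ⟩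
  T * (fromℕ (length xs) + fromℕ (length (concat xss)))  ≡⟨ *-distribˡ-+ T _ _ ⟩
  T * fromℕ (length xs) + T * fromℕ (length (concat xss))
    ≤⟨ +-mono-≤ bound (*-length-concat≤ {T = T} {M} w xss bounds) ⟩
  (sumℚ (map w xs) + M) + (sumℚ (map w (concat xss)) + fromℕ (length xss) * M)
    ≡⟨ regroup (sumℚ (map w xs)) (sumℚ (map w (concat xss))) (fromℕ (length xss)) M ⟩
  (sumℚ (map w xs) + sumℚ (map w (concat xss))) + (1ℚ + fromℕ (length xss)) * M
    ≡⟨ cong₂ _+_ (sumℚ-map-++ w xs (concat xss)) (cong (_* M) (fromℕ-+ 1 (length xss))) ⟨
  sumℚ (map w (xs ++ concat xss)) + fromℕ (suc (length xss)) * M ∎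
  where
  open ≤-Reasoning
  regroup : ∀ a b r m → (a + m) + (b + r * m) ≡ (a + b) + (1ℚ + r) * m
  regroup = solve 4 (λ a b r m → (a :+ m) :+ (b :+ r :* m) := (a :+ b) :+ (con 1ℚ :+ r) :* m) refl

module _ {A : Set} where

  All-updateAt⁺ : ∀ {P : A → Set} {f} xs i → All P xs → P (f (lookup xs i)) → All P (updateAt xs i f)
  All-updateAt⁺ (x ∷ xs) Fin.zero    (_  ∷ pxs) pfx = pfx ∷ pxs
  All-updateAt⁺ (x ∷ xs) (Fin.suc i) (px ∷ pxs) pfx = px ∷ All-updateAt⁺ xs i pxs pfx

  All-updateAt-mono : ∀ {P : A → Set} {f} xs i → (∀ {x} → P x → P (f x)) →
                      All P xs → All P (updateAt xs i f)
  All-updateAt-mono xs i mono pxs = All-updateAt⁺ xs i pxs (mono (All.lookup pxs (∈-lookup {xs = xs} i)))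

  AllPairs-updateAt-mono : ∀ {R : A → A → Set} {f} xs i →
    (∀ {x y} → R x y → R (f x) y) → (∀ {x y} → R x y → R x (f y)) →
    AllPairs R xs → AllPairs R (updateAt xs i f)
  AllPairs-updateAt-mono (x ∷ xs) Fin.zero    monoˡ monoʳ (rx ∷ rxs) = All.map monoˡ rx ∷ rxs
  AllPairs-updateAt-mono (x ∷ xs) (Fin.suc i) monoˡ monoʳ (rx ∷ rxs) =
    All-updateAt-mono xs i monoʳ rx ∷ AllPairs-updateAt-mono xs i monoˡ monoʳ rxs

  concat-updateAt-∷ : ∀ (xss : List (List A)) i x → concat (updateAt xss i (x ∷_)) ↭ x ∷ concat xss
  concat-updateAt-∷ (xs ∷ xss) Fin.zero    x = ↭-refl
  concat-updateAt-∷ (xs ∷ xss) (Fin.suc i) x = begin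
    xs ++ concat (updateAt xss i (x ∷_))   ↭⟨ ++⁺ˡ xs (concat-updateAt-∷ xss i x) ⟩
    xs ++ x ∷ concat xss                   ↭⟨ shift x xs (concat xss) ⟩
    x ∷ xs ++ concat xss                   ∎
    where open PermutationReasoning

  All-lookup⁺ : ∀ {P : A → Set} xs → (∀ i → P (lookup xs i)) → All P xs
  All-lookup⁺ []       _  = []
  All-lookup⁺ (x ∷ xs) px = px Fin.zero ∷ All-lookup⁺ xs (px ∘ Fin.suc)

  AllPairs-lookup : ∀ {R : A → A → Set} {xs i j} → AllPairs R xs → i ≢ j →
                    R (lookup xs i) (lookup xs j) ⊎ R (lookup xs j) (lookup xs i)
  AllPairs-lookup {i = Fin.zero}  {Fin.zero}  (_ ∷ _)    i≢j = contradiction refl i≢j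
  AllPairs-lookup {i = Fin.zero}  {Fin.suc j} (rx ∷ _)   _   = inj₁ (All.lookup rx (∈-lookup j))
  AllPairs-lookup {i = Fin.suc i} {Fin.zero}  (rx ∷ _)   _   = inj₂ (All.lookup rx (∈-lookup i))
  AllPairs-lookup {i = Fin.suc i} {Fin.suc j} (_ ∷ rxs)  i≢j = AllPairs-lookup rxs (i≢j ∘ cong Fin.suc)

  AllPairs-∈ : ∀ {R : A → A → Set} {xs x y} → AllPairs R xs → x ∈ xs → y ∈ xs → x ≢ y → R x y ⊎ R y x
  AllPairs-∈ (rx ∷ _)   (here refl) (here refl) x≢y = contradiction refl x≢y
  AllPairs-∈ (rx ∷ _)   (here refl) (there y∈)  _   = inj₁ (All.lookup rx y∈)
  AllPairs-∈ (rx ∷ _)   (there x∈)  (here refl) _   = inj₂ (All.lookup rx x∈)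
  AllPairs-∈ (_ ∷ rxs)  (there x∈)  (there y∈)  x≢y = AllPairs-∈ rxs x∈ y∈ x≢y

  -- Sending each element of S to a clique containing it is injective: two distinct elements of
  -- S are never R-related, two distinct elements of one clique always are.
  antichain-length≤#cliques : ∀ {R : A → A → Set} → Symmetric R → ∀ {S xss} →
    Unique S → AllPairs (λ x y → ¬ R x y) S → All (AllPairs R) xss → All (_∈ concat xss) S →
    length S ℕ.≤ length xss
  antichain-length≤#cliques {R} R-sym {S} {xss} unique antichain cliques covered =
    Fin.injective⇒≤ clique-of-injective
    where
    clique-of : Fin (length S) → Fin (length xss)
    clique-of i = Any.index (∈-concat⁻ xss (All.lookup covered (∈-lookup i)))

    ∈-clique-of : ∀ i → lookup S i ∈ lookup xss (clique-of i)
    ∈-clique-of i = Any.lookup-index (∈-concat⁻ xss (All.lookup covered (∈-lookup i)))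

    clique-of-injective : ∀ {i j} → clique-of i ≡ clique-of j → i ≡ j
    clique-of-injective {i} {j} same = decidable-stable (i Fin.≟ j) λ i≢j →
      let x≢y = [ id , ≢-sym ]′ (AllPairs-lookup unique i≢j)
          y∈ = subst (λ k → lookup S j ∈ lookup xss k) (sym same) (∈-clique-of j)
          clique = All.lookup cliques (∈-lookup (clique-of i))
          Rxy = [ id , R-sym ]′ (AllPairs-∈ clique (∈-clique-of i) y∈ x≢y)
      in [ (λ ¬Rxy → ¬Rxy Rxy) , (λ ¬Ryx → ¬Ryx (R-sym Rxy)) ]′
           (AllPairs-∈ antichain (∈-lookup i) (∈-lookup j) x≢y)

  Unique-++⁻ˡ : ∀ xs {ys : List A} → Unique (xs ++ ys) → Unique xs
  Unique-++⁻ˡ []       _           = []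
  Unique-++⁻ˡ (x ∷ xs) (x∉ ∷ uniq) = All.++⁻ˡ xs x∉ ∷ Unique-++⁻ˡ xs uniq

  Unique-++⁻ʳ : ∀ xs {ys : List A} → Unique (xs ++ ys) → Unique ys
  Unique-++⁻ʳ []       uniq       = uniq
  Unique-++⁻ʳ (x ∷ xs) (_ ∷ uniq) = Unique-++⁻ʳ xs uniq

  Unique-concat⁻ : ∀ {xss xs} → Unique (concat xss) → xs ∈ xss → Unique xs
  Unique-concat⁻ {ys ∷ xss} uniq (here refl) = Unique-++⁻ˡ ys uniq
  Unique-concat⁻ {ys ∷ xss} uniq (there xs∈) = Unique-concat⁻ (Unique-++⁻ʳ ys uniq) xs∈

  concat-concatMap-↭ : ∀ {B : Set} {f : B → List (List A)} {g : B → List A} →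
    (∀ b → concat (f b) ↭ g b) → ∀ bs → concat (concatMap f bs) ↭ concatMap g bs
  concat-concatMap-↭ f↭g []       = ↭-refl
  concat-concatMap-↭ {f = f} {g} f↭g (b ∷ bs) = begin
    concat (f b ++ concatMap f bs)          ≡⟨ List.concat-++ (f b) (concatMap f bs) ⟨
    concat (f b) ++ concat (concatMap f bs) ↭⟨ ++⁺ (f↭g b) (concat-concatMap-↭ f↭g bs) ⟩
    g b ++ concatMap g bs                   ∎
    where open PermutationReasoning

module _ (I : Instance) where
  open Instance I

  totalLoad : List (List (Fin n)) → ℚ
  totalLoad ds = sumℚ (map (load I) ds)

  totalLoad≡sumℚ-cost : ∀ ds → totalLoad ds ≡ sumℚ (map cost (concat ds))
  totalLoad≡sumℚ-cost []       = refl
  totalLoad≡sumℚ-cost (D ∷ ds) =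
    trans (cong (_+_ (load I D)) (totalLoad≡sumℚ-cost ds)) (sym (sumℚ-map-++ cost D (concat ds)))

  feasibleSolution-↭ : ∀ {ds ds′} → FeasibleSolution I ds → FeasibleSolution I ds′ →
                       concat ds ↭ concat ds′
  feasibleSolution-↭ (_ , covers , unique) (_ , covers′ , unique′) =
    ∼bag⇒↭ (unique∧set⇒bag unique unique′ (mk⇔ (λ _ → covers′ _) (λ _ → covers _)))

  totalLoad≤B*OPT : ∀ {ds opt} → FeasibleSolution I ds → IsOPT I opt → totalLoad ds ≤ B * fromℕ opt
  totalLoad≤B*OPT {ds} solution ((ds* , solution* , refl) , _) = begin
    totalLoad ds                   ≡⟨ totalLoad≡sumℚ-cost ds ⟩
    sumℚ (map cost (concat ds))    ≡⟨ sumℚ-↭ (↭-map⁺ cost (feasibleSolution-↭ solution solution*)) ⟩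
    sumℚ (map cost (concat ds*))   ≡⟨ totalLoad≡sumℚ-cost ds* ⟨
    totalLoad ds*                  ≤⟨ sumℚ≤*-length (load I) ds* (All.map proj₂ (proj₁ solution*)) ⟩
    B * fromℕ (length ds*)         ∎
    where open ≤-Reasoning

  compatible? : ∀ i j → Dec (Compatible I i j)
  compatible? i j = (right i <? left j) ⊎-dec (right j <? left i)

  compatible-sym : Symmetric (Compatible I)
  compatible-sym = Sum.swap

  ω≤OPT : ∀ {ω opt} → IsCliqueNumber I ω → IsOPT I opt → ω ℕ.≤ opt
  ω≤OPT ((S , (unique , conflicting) , refl) , _) ((ds , (feasible , covers , _) , refl) , _) =
    antichain-length≤#cliques compatible-sym unique conflicting
      (All.map proj₁ feasible) (All.tabulate λ {j} _ → covers j)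

  module _ {ω} {col : Fin n → Fin ω} (proper : ProperColoring I ω col) where

    monochromatic⇒compatible : ∀ {k D} → Unique D → All (λ j → col j ≡ k) D → AllPairs (Compatible I) D
    monochromatic⇒compatible []             []         = []
    monochromatic⇒compatible (x≢ ∷ unique) (cx ∷ cols) =
      All.zipWith (λ (x≢y , cy) → compatible-if-same-colour x≢y (trans cx (sym cy))) (x≢ , cols)
        ∷ monochromatic⇒compatible unique cols
      where
      compatible-if-same-colour : ∀ {i j} → i ≢ j → col i ≡ col j → Compatible I i j
      compatible-if-same-colour {i} {j} i≢j same =
        decidable-stable (compatible? i j) λ conflict → proper i j i≢j conflict same

  ffRun-↭ : ∀ {ds js out} → FFRun I ds js out → concat out ↭ concat ds ++ js
  ffRun-↭ {ds} done = ↭-reflexive (sym (List.++-identityʳ (concat ds)))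
  ffRun-↭ {ds} {j ∷ js} {out} (old i _ run) = begin
    concat out                           ↭⟨ ffRun-↭ run ⟩
    concat (updateAt ds i (j ∷_)) ++ js  ↭⟨ ↭-++⁺ʳ js (concat-updateAt-∷ ds i j) ⟩
    j ∷ concat ds ++ js                  ↭⟨ shift j (concat ds) js ⟨
    concat ds ++ j ∷ js                  ∎
    where open PermutationReasoning
  ffRun-↭ {ds} {j ∷ js} {out} (new _ run) = begin
    concat out                           ↭⟨ ffRun-↭ run ⟩
    concat (ds ++ [ [ j ] ]) ++ js       ≡⟨ cong (_++ js) (List.concat-++ ds [ [ j ] ]) ⟨
    (concat ds ++ [ j ]) ++ js           ≡⟨ List.++-assoc (concat ds) [ j ] js ⟩
    concat ds ++ j ∷ js                  ∎
    where open PermutationReasoning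

  module _ (P : List (List (Fin n)) → Set)
           (old-step : ∀ {ds j} i → cost j ≤ B - load I (lookup ds i) → P ds → P (updateAt ds i (j ∷_)))
           (new-step : ∀ {ds j} → (∀ i → B - load I (lookup ds i) < cost j) →
                       P ds → P (ds ++ [ [ j ] ])) where

    ffRun-preserves : ∀ {ds js out} → FFRun I ds js out → P ds → P out
    ffRun-preserves done             p = p
    ffRun-preserves (old i fits run) p = ffRun-preserves run (old-step i fits p)
    ffRun-preserves (new full run)   p = ffRun-preserves run (new-step full p)

  load≤load-∷ : ∀ j D → load I D ≤ load I (j ∷ D)
  load≤load-∷ j D = begin
    load I D             ≡⟨ +-identityˡ (load I D) ⟨
    0ℚ + load I D        ≤⟨ +-monoˡ-≤ (load I D) (<⇒≤ (cost-pos j)) ⟩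
    cost j + load I D    ∎
    where open ≤-Reasoning

  load-[_] : ∀ j → load I [ j ] ≡ cost j
  load-[ j ] = +-identityʳ (cost j)

  ffRun-load≤B : ∀ {js out} → FFRun I [] js out → All (λ D → load I D ≤ B) out
  ffRun-load≤B run = ffRun-preserves (All (λ D → load I D ≤ B)) load-fits new-load≤B run []
    where
    sub-add : ∀ p q → p - q + q ≡ p
    sub-add = solve 2 (λ p q → p :- q :+ q := p) refl
    load-fits : ∀ {ds j} i → cost j ≤ B - load I (lookup ds i) →
                All (λ D → load I D ≤ B) ds → All (λ D → load I D ≤ B) (updateAt ds i (j ∷_))
    load-fits {ds} {j} i fits loads≤B = All-updateAt⁺ ds i loads≤B (begin
      cost j + load I (lookup ds i)                    ≤⟨ +-monoˡ-≤ _ fits ⟩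
      B - load I (lookup ds i) + load I (lookup ds i)  ≡⟨ sub-add B _ ⟩
      B                                                ∎)
      where open ≤-Reasoning
    new-load≤B : ∀ {ds j} → _ → All (λ D → load I D ≤ B) ds →
                 All (λ D → load I D ≤ B) (ds ++ [ [ j ] ])
    new-load≤B {j = j} _ loads≤B = All.++⁺ loads≤B (subst (_≤ B) (sym load-[ j ]) (cost≤B j) ∷ [])

  ffRun-c≤load : ∀ {c} → (∀ j → c ≤ cost j) → ∀ {js out} → FFRun I [] js out →
                 All (λ D → c ≤ load I D) out
  ffRun-c≤load {c} c≤cost run = ffRun-preserves (All (λ D → c ≤ load I D))
    (λ {ds} {j} i _ → All-updateAt-mono ds i (λ {D} c≤D → ≤-trans c≤D (load≤load-∷ j D)))
    (λ {ds} {j} _ c≤loads → All.++⁺ c≤loads (subst (c ≤_) (sym load-[ j ]) (c≤cost j) ∷ []))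
    run []

  -- A drone is opened for j only when j fits in no open drone. If j is small, every open drone
  -- is therefore loaded beyond T already; otherwise the new drone itself is.
  ffRun-at-most-one-below : ∀ {T} → (∀ j → cost j ≤ B - T ⊎ T ≤ cost j) →
                            ∀ {js out} → FFRun I [] js out →
                            AllPairs (λ D D′ → T ≤ load I D ⊎ T ≤ load I D′) out
  ffRun-at-most-one-below {T} small-or-large run =
    ffRun-preserves (AllPairs (λ D D′ → T ≤ load I D ⊎ T ≤ load I D′))
    (λ {ds} {j} i _ → AllPairs-updateAt-mono ds i
      (λ {D} → Sum.map₁ (grows j D)) (λ {_} {D} → Sum.map₂ (grows j D)))
    (λ {ds} {j} full below → AllPairs.++⁺ below ([] ∷ []) (All.map (_∷ []) (open-vs-new full)))
    run []
    where
    grows : ∀ j D → T ≤ load I D → T ≤ load I (j ∷ D)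
    grows j D T≤D = ≤-trans T≤D (load≤load-∷ j D)
    reflect : ∀ b t → t ≡ b - (b - t)
    reflect = solve 2 (λ b t → t := b :- (b :- t)) refl
    open-vs-new : ∀ {ds j} → (∀ i → B - load I (lookup ds i) < cost j) →
                  All (λ D → T ≤ load I D ⊎ T ≤ load I [ j ]) ds
    open-vs-new {ds} {j} full with small-or-large j
    ... | inj₂ large = All.tabulate (λ _ → inj₂ (subst (T ≤_) (sym load-[ j ]) large))
    ... | inj₁ small = All-lookup⁺ ds λ i → inj₁ (<⇒≤ (begin-strict
      T                                  ≡⟨ reflect B T ⟩
      B - (B - T)                        <⟨ +-monoʳ-< B (neg-antimono-< (<-≤-trans (full i) small)) ⟩
      B - (B - load I (lookup ds i))     ≡⟨ reflect B _ ⟨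
      load I (lookup ds i)               ∎))
      where open ≤-Reasoning

  module AlgorithmRun {ω} {col : Fin n → Fin ω} (proper : ProperColoring I ω col)
                      {ord : Fin ω → List (Fin n)} (ord-unique : ∀ k → Unique (ord k))
                      (ord-class : ∀ k j → (j ∈ ord k) ⇔ (col j ≡ k))
                      {out : Fin ω → List (List (Fin n))} (runs : ∀ k → FFRun I [] (ord k) (out k)) where

    output : List (List (Fin n))
    output = concatMap out (allFin ω)

    class-↭ : ∀ k → concat (out k) ↭ ord k
    class-↭ k = ffRun-↭ (runs k)

    drone-feasible : ∀ {k D} → D ∈ out k → FeasibleDrone I D
    drone-feasible {k} {D} D∈ =
      monochromatic⇒compatible proper unique coloured , All.lookup (ffRun-load≤B (runs k)) D∈
      where
      unique : Unique D
      unique = Unique-concat⁻ (Unique-resp-↭ (↭-sym (class-↭ k)) (ord-unique k)) D∈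
      coloured : All (λ j → col j ≡ k) D
      coloured = All.tabulate λ {j} j∈D →
        Equivalence.to (ord-class k j) (∈-resp-↭ (class-↭ k) (∈-concat⁺′ j∈D D∈))

    output-↭ : concat output ↭ concatMap ord (allFin ω)
    output-↭ = concat-concatMap-↭ class-↭ (allFin ω)

    output-unique : Unique (concat output)
    output-unique = Unique-resp-↭ (↭-sym output-↭)
      (Unique.concat⁺ (All.map⁺ (All.tabulate λ {k} _ → ord-unique k))
                      (AllPairs.map⁺ (AllPairs.map disjoint (Unique.allFin⁺ ω))))
      where
      disjoint : ∀ {k k′} → k ≢ k′ → Disjoint (ord k) (ord k′)
      disjoint {k} {k′} k≢k′ {j} (j∈k , j∈k′) =
        k≢k′ (trans (sym (Equivalence.to (ord-class k j) j∈k)) (Equivalence.to (ord-class k′ j) j∈k′))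

    output-covers : ∀ j → j ∈ concat output
    output-covers j = ∈-resp-↭ (↭-sym output-↭)
      (∈-concat⁺′ (Equivalence.from (ord-class (col j) j) refl) (∈-map⁺ ord (∈-allFin (col j))))

    output-feasible : FeasibleSolution I output
    output-feasible =
      All.concat⁺ (All.map⁺ {xs = allFin ω} (All.tabulate λ _ → All.tabulate drone-feasible)) ,
      output-covers , output-unique

    output-lower : ∀ {c} → (∀ j → c ≤ cost j) → c * fromℕ (length output) ≤ totalLoad output
    output-lower c≤cost =
      *-length≤sumℚ (load I) output
        (All.concat⁺ (All.map⁺ {xs = allFin ω} (All.tabulate λ {k} _ → ffRun-c≤load c≤cost (runs k))))

    output-count : ∀ {c T} → (∀ j → c ≤ cost j) → (∀ j → cost j ≤ B - T ⊎ T ≤ cost j) →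
                   T * fromℕ (length output) ≤ totalLoad output + fromℕ ω * (0ℚ ⊔ (T - c))
    output-count {c} {T} c≤cost small-or-large =
      subst (λ m → T * fromℕ (length output) ≤ totalLoad output + fromℕ m * (0ℚ ⊔ (T - c))) #classes
        (*-length-concat≤ {T = T} {0ℚ ⊔ (T - c)} (load I) (map out (allFin ω))
          (All.map⁺ (All.tabulate λ {k} _ → *-length≤sumℚ+gap (load I) (out k)
            (ffRun-c≤load c≤cost (runs k)) (ffRun-at-most-one-below small-or-large (runs k)))))
      where
      #classes : length (map out (allFin ω)) ≡ ω
      #classes = trans (List.length-map out (allFin ω)) (List.length-tabulate id)

  minCost≤cost : ∀ j → minCost I ≤ cost j
  minCost≤cost j =
    All.lookup (List.foldr-forcesᵇ bound B (map cost (allFin n)) ≤-refl) (∈-map⁺ cost (∈-allFin j))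
    where
    bound : ∀ x y → minCost I ≤ x ⊓ y → minCost I ≤ x × minCost I ≤ y
    bound x y m≤x⊓y = ≤-trans m≤x⊓y (p⊓q≤p x y) , ≤-trans m≤x⊓y (p⊓q≤q x y)

  minCost≤B : minCost I ≤ B
  minCost≤B =
    List.foldr-preservesʳ {P = _≤ B} (λ x {y} y≤B → ≤-trans (p⊓q≤q x y) y≤B) ≤-refl (map cost (allFin n))

  cost≤maxCost : ∀ j → cost j ≤ maxCost I
  cost≤maxCost j =
    All.lookup (List.foldr-forcesᵇ bound 0ℚ (map cost (allFin n)) ≤-refl) (∈-map⁺ cost (∈-allFin j))
    where
    bound : ∀ x y → x ⊔ y ≤ maxCost I → x ≤ maxCost I × y ≤ maxCost I
    bound x y x⊔y≤m = ≤-trans (p≤p⊔q x y) x⊔y≤m , ≤-trans (p≤q⊔p x y) x⊔y≤m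

  B≢0 : B ≢ 0ℚ
  B≢0 = ≢-sym (<⇒≢ B-pos)

  εmin*B≤cost : ∀ j → εmin I * B ≤ cost j
  εmin*B≤cost j = subst (_≤ cost j) (sym (/?-*-cancel (minCost I) B≢0)) (minCost≤cost j)

  εmin≤1 : εmin I ≤ 1ℚ
  εmin≤1 = *-cancelʳ-≤-pos B {{positive B-pos}} (begin
    εmin I * B     ≡⟨ /?-*-cancel (minCost I) B≢0 ⟩
    minCost I      ≤⟨ minCost≤B ⟩
    B              ≡⟨ *-identityˡ B ⟨
    1ℚ * B         ∎)
    where open ≤-Reasoning

  εmax<1 : εmax I < 1ℚ
  εmax<1 = ≤-<-trans (p⊓q≤p ½ (maxCost I /? B)) (*<* (ℤ.+<+ (ℕ.s≤s (ℕ.s≤s ℕ.z≤n))))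

  -- Either ε_max B is the largest cost, or ε_max = 1/2 and then (1 - ε_max) B = ε_max B.
  cost-small-or-large : ∀ j → cost j ≤ B - (1ℚ - εmax I) * B ⊎ (1ℚ - εmax I) * B ≤ cost j
  cost-small-or-large j =
    Sum.map₁ (subst (cost j ≤_) (sym (complement B (εmax I)))) (by-cases (⊓-sel ½ (maxCost I /? B)))
    where
    complement : ∀ b e → b - (1ℚ - e) * b ≡ e * b
    complement = solve 2 (λ b e → b :- (con 1ℚ :- e) :* b := e :* b) refl
    by-cases : εmax I ≡ ½ ⊎ εmax I ≡ maxCost I /? B →
               cost j ≤ εmax I * B ⊎ (1ℚ - εmax I) * B ≤ cost j
    by-cases (inj₂ εmax≡) = inj₁ (begin
      cost j                  ≤⟨ cost≤maxCost j ⟩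
      maxCost I               ≡⟨ /?-*-cancel (maxCost I) B≢0 ⟨
      maxCost I /? B * B      ≡⟨ cong (_* B) εmax≡ ⟨
      εmax I * B              ∎)
      where open ≤-Reasoning
    by-cases (inj₁ εmax≡½) = Sum.map₂ (subst (_≤ cost j) half) (≤-total (cost j) (εmax I * B))
      where
      half : εmax I * B ≡ (1ℚ - εmax I) * B
      half = trans (cong (_* B) εmax≡½) (cong (λ e → (1ℚ - e) * B) (sym εmax≡½))

corollary2 : (I : Instance) (ds : List (List (Fin (Instance.n I)))) (opt : ℕ) →
    AlgoOutput I ds → IsOPT I opt →
    FeasibleSolution I ds × ((+ length ds) / 1 ≤ ratio I * ((+ opt) / 1))
corollary2 I _ opt (ω , isω , col , proper , ord , ord-unique , ord-class , out , runs , refl) isOPT =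
  output-feasible ,
  ratio-bound (εmax<1 I) B-pos (εmin≤1 I)
    (output-count (εmin*B≤cost I) (cost-small-or-large I))
    (output-lower (εmin*B≤cost I))
    (totalLoad≤B*OPT I output-feasible isOPT)
    (fromℕ-mono-≤ (ω≤OPT I isω isOPT))
    (fromℕ-nonNeg opt)
  where
  open Instance I using (B-pos)
  open AlgorithmRun I proper ord-unique ord-class runs
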